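{- Let $L$ be a nonempty set and let $X, Y \subseteq L$. Define $C(X,Y)\colon \mathcal P(L)\to\mathcal P(L)$ by: for $A\subseteq L$, $C(X,Y)(A)=A\cup X$ if $A\cap Y\neq\emptyset$, and $C(X,Y)(A)=A$ if $A\cap Y=\emptyset$. Define $C'(X,Y)\colon \mathcal P(L)\to\mathcal P(L)$ by: $C'(X,Y)(A)=A\cup X$ if $Y\subseteq A$, and $C'(X,Y)(A)=A$ if $Y\not\subseteq A$. Then $C(X,Y)$ is a finite consequence operator on $L$ and $C'(X,Y)$ is a consequence operator on $L$. If moreover $Y$ is finite, then $C'(X,Y)$ is a finite consequence operator.
   Context: A consequence operator on a nonempty set $L$ is a map $C\colon\mathcal P(L)\to\mathcal P(L)$ such that for all $X,Y\subseteq L$: (i) $X\subseteq C(X)=C(C(X))\subseteq L$, and (ii) if $X\subseteq Y$ then $C(X)\subseteq C(Y)$. It is finite (finitary, algebraic) if in addition (iii) $C(X)=\bigcup\{C(A): A \text{ a finite subset of } X\}$ for every $X\subseteq L$ (the empty set counts as finite). -}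

module Defs where

open import Level using (0ℓ)
open import Data.Product using (Σ; ∃; _×_)
open import Data.Sum using (_⊎_)
open import Data.List using (List)
open import Data.List.Membership.Propositional using () renaming (_∈_ to _∈ₗ_)
open import Relation.Unary using (Pred; _∈_; _⊆_; _≐_)

Subset : Set → Set₁
Subset L = Pred L 0ℓ

fromList : {L : Set} → List L → Subset L
fromList as = λ a → a ∈ₗ as

IsFiniteSet : {L : Set} → Subset L → Set
IsFiniteSet {L} Y = ∃ λ (as : List L) → Y ≐ fromList as

IsConsequenceOperator : {L : Set} → (Subset L → Subset L) → Set₁
IsConsequenceOperator {L} C =
  (∀ (X : Subset L) → X ⊆ C X) ×
  (∀ (X : Subset L) → C X ≐ C (C X)) ×
  (∀ (X Y : Subset L) → X ⊆ Y → C X ⊆ C Y)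

⋃FiniteSubsets : {L : Set} → (Subset L → Subset L) → Subset L → Subset L
⋃FiniteSubsets {L} C X = λ x → ∃ λ (as : List L) → (fromList as ⊆ X) × (x ∈ C (fromList as))

IsFiniteConsequenceOperator : {L : Set} → (Subset L → Subset L) → Set₁
IsFiniteConsequenceOperator {L} C =
  IsConsequenceOperator C × (∀ (X : Subset L) → C X ≐ ⋃FiniteSubsets C X)

Cop : {L : Set} → Subset L → Subset L → Subset L → Subset L
Cop {L} X Y A = λ x → (x ∈ A) ⊎ ((x ∈ X) × (∃ λ (y : L) → (y ∈ A) × (y ∈ Y)))

Cop' : {L : Set} → Subset L → Subset L → Subset L → Subset L
Cop' {L} X Y A = λ x → (x ∈ A) ⊎ ((x ∈ X) × (Y ⊆ A))

-- Both operators only ever add X, and applying them twice cannot trigger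
-- anything new: a point of C(X,Y)(A) ∩ Y either lies in A or already certifies
-- A ∩ Y ≠ ∅, and Y ⊆ C'(X,Y)(A) forces Y ⊆ A for the same reason.  Membership
-- in C(X,Y)(A) is witnessed by a single point of A, and membership in
-- C'(X,Y)(A) by the points of Y, so both are finitary as soon as those
-- witnesses form a finite set.
module Submission where

open import Defs
open import Data.Product using (_×_; _,_)
open import Data.Sum using (inj₁; inj₂)
open import Data.List using ([]; _∷_)
open import Data.List.Relation.Unary.Any using (here)
open import Relation.Binary.PropositionalEquality using (refl)
open import Relation.Unary using (_∈_; _⊆_)

module _ {L : Set} where

  Monotone : (Subset L → Subset L) → Set₁
  Monotone C = ∀ (A B : Subset L) → A ⊆ B → C A ⊆ C B

  singleton⊆ : ∀ {A : Subset L} {x : L} → x ∈ A → fromList (x ∷ []) ⊆ A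
  singleton⊆ x∈A (here refl) = x∈A

  ⋃FiniteSubsets⊆ : ∀ {C : Subset L → Subset L} → Monotone C →
    ∀ (A : Subset L) → ⋃FiniteSubsets C A ⊆ C A
  ⋃FiniteSubsets⊆ mono A (as , as⊆A , x∈Cas) = mono _ A as⊆A x∈Cas

  isConsequenceOperator : ∀ {C : Subset L → Subset L} →
    (∀ (A : Subset L) → A ⊆ C A) →
    (∀ (A : Subset L) → C (C A) ⊆ C A) →
    Monotone C →
    IsConsequenceOperator C
  isConsequenceOperator inflate idem mono =
    inflate , (λ A → inflate _ , idem A) , mono

  isFiniteConsequenceOperator : ∀ {C : Subset L → Subset L} →
    IsConsequenceOperator C →
    (∀ (A : Subset L) → C A ⊆ ⋃FiniteSubsets C A) →
    IsFiniteConsequenceOperator C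
  isFiniteConsequenceOperator isCO@(_ , _ , mono) compact =
    isCO , λ A → compact A , ⋃FiniteSubsets⊆ mono A

module _ {L : Set} (X Y : Subset L) where

  Cop-monotone : Monotone (Cop X Y)
  Cop-monotone A B A⊆B (inj₁ x∈A)                 = inj₁ (A⊆B x∈A)
  Cop-monotone A B A⊆B (inj₂ (x∈X , y , y∈A , y∈Y)) = inj₂ (x∈X , y , A⊆B y∈A , y∈Y)

  Cop-idempotent : ∀ (A : Subset L) → Cop X Y (Cop X Y A) ⊆ Cop X Y A
  Cop-idempotent A (inj₁ x∈CA)                             = x∈CA
  Cop-idempotent A (inj₂ (x∈X , y , inj₁ y∈A , y∈Y))        = inj₂ (x∈X , y , y∈A , y∈Y)
  Cop-idempotent A (inj₂ (x∈X , _ , inj₂ (_ , A∩Y≢∅) , _)) = inj₂ (x∈X , A∩Y≢∅)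

  Cop-compact : ∀ (A : Subset L) → Cop X Y A ⊆ ⋃FiniteSubsets (Cop X Y) A
  Cop-compact A {x} (inj₁ x∈A) =
    x ∷ [] , singleton⊆ x∈A , inj₁ (here refl)
  Cop-compact A (inj₂ (x∈X , y , y∈A , y∈Y)) =
    y ∷ [] , singleton⊆ y∈A , inj₂ (x∈X , y , here refl , y∈Y)

  Cop-isFiniteConsequenceOperator : IsFiniteConsequenceOperator (Cop X Y)
  Cop-isFiniteConsequenceOperator = isFiniteConsequenceOperator
    (isConsequenceOperator (λ _ → inj₁) Cop-idempotent Cop-monotone)
    Cop-compact

  Cop'-monotone : Monotone (Cop' X Y)
  Cop'-monotone A B A⊆B (inj₁ x∈A)         = inj₁ (A⊆B x∈A)
  Cop'-monotone A B A⊆B (inj₂ (x∈X , Y⊆A)) = inj₂ (x∈X , λ y∈Y → A⊆B (Y⊆A y∈Y))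

  Cop'-idempotent : ∀ (A : Subset L) → Cop' X Y (Cop' X Y A) ⊆ Cop' X Y A
  Cop'-idempotent A (inj₁ x∈C'A)         = x∈C'A
  Cop'-idempotent A (inj₂ (x∈X , Y⊆C'A)) = inj₂ (x∈X , λ y∈Y → Cop'∩Y⊆A y∈Y (Y⊆C'A y∈Y))
    where
    Cop'∩Y⊆A : ∀ {y} → y ∈ Y → y ∈ Cop' X Y A → y ∈ A
    Cop'∩Y⊆A _   (inj₁ y∈A)       = y∈A
    Cop'∩Y⊆A y∈Y (inj₂ (_ , Y⊆A)) = Y⊆A y∈Y

  Cop'-isConsequenceOperator : IsConsequenceOperator (Cop' X Y)
  Cop'-isConsequenceOperator =
    isConsequenceOperator (λ _ → inj₁) Cop'-idempotent Cop'-monotone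

  Cop'-compact : IsFiniteSet Y →
    ∀ (A : Subset L) → Cop' X Y A ⊆ ⋃FiniteSubsets (Cop' X Y) A
  Cop'-compact _ A {x} (inj₁ x∈A) =
    x ∷ [] , singleton⊆ x∈A , inj₁ (here refl)
  Cop'-compact (ys , Y⊆ys , ys⊆Y) A (inj₂ (x∈X , Y⊆A)) =
    ys , (λ y∈ys → Y⊆A (ys⊆Y y∈ys)) , inj₂ (x∈X , Y⊆ys)

  Cop'-isFiniteConsequenceOperator :
    IsFiniteSet Y → IsFiniteConsequenceOperator (Cop' X Y)
  Cop'-isFiniteConsequenceOperator finY =
    isFiniteConsequenceOperator Cop'-isConsequenceOperator (Cop'-compact finY)

theorem2p5 : (L : Set) → L → (X Y : Subset L) →
    IsFiniteConsequenceOperator (Cop X Y) ×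
    IsConsequenceOperator (Cop' X Y) ×
    (IsFiniteSet Y → IsFiniteConsequenceOperator (Cop' X Y))
theorem2p5 L _ X Y =
  Cop-isFiniteConsequenceOperator X Y ,
  Cop'-isConsequenceOperator X Y ,
  Cop'-isFiniteConsequenceOperator X Y
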